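{- Let $A \in \mathbb{Z}^{m\times n}$, $b \in \mathbb{Z}^m$, $c \in \mathbb{Z}^n$ be such that the integer linear program $\min\{c^{\mathsf{T}} x : Ax = b,\ x \in \mathbb{Z}_{\ge 0}^n\}$ is bounded and feasible, and let $x^* \in \mathbb{Z}_{\ge 0}^n$ be its lexicographically minimal optimal solution. Then there exist $x' \in \{0,1\}^n$ and $b' \in \mathbb{Z}^m$ such that (i) $x'$ is the lexicographically minimal optimal solution to $\min\{c^{\mathsf{T}} x : Ax = b',\ x \in \mathbb{Z}_{\ge 0}^n\}$, and (ii) $\mathrm{supp}(x') = \mathrm{supp}(x^*)$.
   Context: For $x \in \mathbb{Z}^n$, $\mathrm{supp}(x) = \{i \in [n] : x_i \neq 0\}$. For $x, y \in \mathbb{Z}_{\ge 0}^n$, $x$ is lexicographically smaller than $y$ if there is an index $i$ with $x_j = y_j$ for all $j < i$ and $x_i < y_i$. -}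

module Defs where

open import Data.Nat as ℕ using (ℕ)
open import Data.Integer as ℤ using (ℤ; +_)
open import Data.Fin using (Fin)
open import Data.Fin.Base using (zero; suc)
open import Data.Product using (Σ; ∃; _×_; _,_)
open import Relation.Binary.PropositionalEquality using (_≡_)
open import Relation.Nullary using (¬_)

Matrix : ℕ → ℕ → Set
Matrix m n = Fin m → Fin n → ℤ

sumℤ : {n : ℕ} → (Fin n → ℤ) → ℤ
sumℤ {ℕ.zero} f = + 0
sumℤ {ℕ.suc n} f = f zero ℤ.+ sumℤ (λ j → f (suc j))

mulVec : {m n : ℕ} → Matrix m n → (Fin n → ℕ) → Fin m → ℤ
mulVec A x i = sumℤ (λ j → A i j ℤ.* + x j)

dot : {n : ℕ} → (Fin n → ℤ) → (Fin n → ℕ) → ℤ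
dot c x = sumℤ (λ j → c j ℤ.* + x j)

Feasible : {m n : ℕ} → Matrix m n → (Fin m → ℤ) → (Fin n → ℕ) → Set
Feasible A b x = ∀ i → mulVec A x i ≡ b i

Bounded : {m n : ℕ} → Matrix m n → (Fin m → ℤ) → (Fin n → ℤ) → Set
Bounded A b c = ∃ λ L → ∀ x → Feasible A b x → L ℤ.≤ dot c x

Optimal : {m n : ℕ} → Matrix m n → (Fin m → ℤ) → (Fin n → ℤ) → (Fin n → ℕ) → Set
Optimal A b c x = Feasible A b x × (∀ y → Feasible A b y → dot c x ℤ.≤ dot c y)

LexLess : {n : ℕ} → (Fin n → ℕ) → (Fin n → ℕ) → Set
LexLess {n} x y = Σ (Fin n) λ i →
  (∀ (j : Fin n) → j Data.Fin.< i → x j ≡ y j) × (x i ℕ.< y i)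

LexMinOptimal : {m n : ℕ} → Matrix m n → (Fin m → ℤ) → (Fin n → ℤ) → (Fin n → ℕ) → Set
LexMinOptimal A b c x = Optimal A b c x × (∀ y → Optimal A b c y → ¬ LexLess y x)

SameSupport : {n : ℕ} → (Fin n → ℕ) → (Fin n → ℕ) → Set
SameSupport x y = ∀ i → (¬ x i ≡ 0 → ¬ y i ≡ 0) × (¬ y i ≡ 0 → ¬ x i ≡ 0)

-- Write x* = d + x′ with x′ the 0/1 indicator of supp(x*) and d ≥ 0. If y is feasible
-- for b′ = A x′ then d + y is feasible for b; the objective only shifts by the constant
-- c·d, and y <lex x′ gives d + y <lex d + x′ = x*. So x′ is optimal for b′, and an optimal
-- y beating x′ lexicographically would yield an optimal d + y beating x* for b.
module Submission where

open import Defs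
open import Data.Nat using (ℕ; _≤_)
open import Data.Integer using (ℤ; +_; -_; _+_; _*_)
open import Data.Fin using (Fin)
open import Data.Product using (Σ; ∃; _×_; _,_)

import Data.Nat as ℕ
import Data.Nat.Properties as ℕ
import Data.Integer as ℤ
import Data.Integer.Properties as ℤ
open import Data.Fin using (zero; suc)
open import Data.Vec.Functional using (zipWith)
open import Relation.Binary.PropositionalEquality
open import Relation.Nullary using (¬_)
open import Algebra.Properties.CommutativeSemigroup ℤ.+-commutativeSemigroup using (interchange)
open import Algebra.Properties.AbelianGroup ℤ.+-0-abelianGroup using (\\-leftDividesʳ)

infixl 6 _⊕_

_⊕_ : ∀ {n} → (Fin n → ℕ) → (Fin n → ℕ) → Fin n → ℕ
_⊕_ = zipWith ℕ._+_

sumℤ-cong : ∀ {n} {f g : Fin n → ℤ} → (∀ j → f j ≡ g j) → sumℤ f ≡ sumℤ g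
sumℤ-cong {ℕ.zero}  f≗g = refl
sumℤ-cong {ℕ.suc n} f≗g = cong₂ _+_ (f≗g zero) (sumℤ-cong (λ j → f≗g (suc j)))

sumℤ-+ : ∀ {n} (f g : Fin n → ℤ) → sumℤ (λ j → f j + g j) ≡ sumℤ f + sumℤ g
sumℤ-+ {ℕ.zero}  f g = refl
sumℤ-+ {ℕ.suc n} f g = begin
  f zero + g zero + sumℤ (λ j → f (suc j) + g (suc j))
    ≡⟨ cong (_+_ (f zero + g zero)) (sumℤ-+ (λ j → f (suc j)) (λ j → g (suc j))) ⟩
  f zero + g zero + (sumℤ (λ j → f (suc j)) + sumℤ (λ j → g (suc j)))
    ≡⟨ interchange (f zero) (g zero) _ _ ⟩
  sumℤ f + sumℤ g ∎
  where open ≡-Reasoning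

dot-cong : ∀ {n} (c : Fin n → ℤ) {x y : Fin n → ℕ} → (∀ j → x j ≡ y j) → dot c x ≡ dot c y
dot-cong c x≗y = sumℤ-cong (λ j → cong (λ t → c j * + t) (x≗y j))

dot-⊕ : ∀ {n} (c : Fin n → ℤ) (x y : Fin n → ℕ) → dot c (x ⊕ y) ≡ dot c x + dot c y
dot-⊕ c x y = begin
  sumℤ (λ j → c j * + (x j ℕ.+ y j))
    ≡⟨ sumℤ-cong (λ j → trans (cong (c j *_) (ℤ.pos-+ (x j) (y j)))
                              (ℤ.*-distribˡ-+ (c j) (+ x j) (+ y j))) ⟩
  sumℤ (λ j → c j * + x j + c j * + y j)
    ≡⟨ sumℤ-+ (λ j → c j * + x j) (λ j → c j * + y j) ⟩
  dot c x + dot c y ∎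
  where open ≡-Reasoning

+-cancelˡ-≤ : ∀ a {i j} → a + i ℤ.≤ a + j → i ℤ.≤ j
+-cancelˡ-≤ a {i} {j} a+i≤a+j =
  subst₂ ℤ._≤_ (\\-leftDividesʳ a i) (\\-leftDividesʳ a j) (ℤ.+-monoʳ-≤ (- a) a+i≤a+j)

module _ {m n : ℕ} (A : Matrix m n) (c : Fin n → ℤ) {b : Fin m → ℤ}
         {z d x : Fin n → ℕ} (z≗d⊕x : ∀ j → z j ≡ d j ℕ.+ x j) where

  Feasible-shift : Feasible A b z → ∀ y → Feasible A (mulVec A x) y → Feasible A b (d ⊕ y)
  Feasible-shift z-feasible y y-feasible i = begin
    mulVec A (d ⊕ y) i               ≡⟨ dot-⊕ (A i) d y ⟩
    mulVec A d i + mulVec A y i    ≡⟨ cong (_+_ (mulVec A d i)) (y-feasible i) ⟩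
    mulVec A d i + mulVec A x i    ≡⟨ dot-⊕ (A i) d x ⟨
    mulVec A (d ⊕ x) i               ≡⟨ dot-cong (A i) z≗d⊕x ⟨
    mulVec A z i                     ≡⟨ z-feasible i ⟩
    b i                              ∎
    where open ≡-Reasoning

  dot-shift : dot c z ≡ dot c d + dot c x
  dot-shift = trans (dot-cong c z≗d⊕x) (dot-⊕ c d x)

  LexLess-shift : ∀ {y} → LexLess y x → LexLess (d ⊕ y) z
  LexLess-shift {y} (i , y≡x-before-i , yᵢ<xᵢ) =
    i , (λ j j<i → trans (cong (d j ℕ.+_) (y≡x-before-i j j<i)) (sym (z≗d⊕x j)))
      , subst (d i ℕ.+ y i ℕ.<_) (sym (z≗d⊕x i)) (ℕ.+-monoʳ-< (d i) yᵢ<xᵢ)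

  Optimal-shift : Optimal A b c z → Optimal A (mulVec A x) c x
  Optimal-shift (z-feasible , z-optimal) = (λ i → refl) , x-optimal
    where
    x-optimal : ∀ y → Feasible A (mulVec A x) y → dot c x ℤ.≤ dot c y
    x-optimal y y-feasible = +-cancelˡ-≤ (dot c d) (begin
      dot c d + dot c x  ≡⟨ dot-shift ⟨
      dot c z              ≤⟨ z-optimal (d ⊕ y) (Feasible-shift z-feasible y y-feasible) ⟩
      dot c (d ⊕ y)        ≡⟨ dot-⊕ c d y ⟩
      dot c d + dot c y  ∎)
      where open ℤ.≤-Reasoning

  LexMinOptimal-shift : LexMinOptimal A b c z → LexMinOptimal A (mulVec A x) c x
  LexMinOptimal-shift ((z-feasible , z-optimal) , z-lexmin) =
    Optimal-shift (z-feasible , z-optimal) , x-lexmin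
    where
    x-lexmin : ∀ y → Optimal A (mulVec A x) c y → ¬ LexLess y x
    x-lexmin y (y-feasible , y-optimal) y<x =
      z-lexmin (d ⊕ y) (Feasible-shift z-feasible y y-feasible , d⊕y-optimal) (LexLess-shift y<x)
      where
      open ℤ.≤-Reasoning
      d⊕y-optimal : ∀ w → Feasible A _ w → dot c (d ⊕ y) ℤ.≤ dot c w
      d⊕y-optimal w w-feasible = begin
        dot c (d ⊕ y)        ≡⟨ dot-⊕ c d y ⟩
        dot c d + dot c y  ≤⟨ ℤ.+-monoʳ-≤ (dot c d) (y-optimal x (λ i → refl)) ⟩
        dot c d + dot c x  ≡⟨ dot-shift ⟨
        dot c z              ≤⟨ z-optimal w w-feasible ⟩
        dot c w              ∎

indicator : ℕ → ℕ
indicator ℕ.zero    = 0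
indicator (ℕ.suc _) = 1

indicator≤1 : ∀ k → indicator k ≤ 1
indicator≤1 ℕ.zero    = ℕ.z≤n
indicator≤1 (ℕ.suc _) = ℕ.s≤s ℕ.z≤n

indicator≢0⇔≢0 : ∀ k → (¬ indicator k ≡ 0 → ¬ k ≡ 0) × (¬ k ≡ 0 → ¬ indicator k ≡ 0)
indicator≢0⇔≢0 ℕ.zero    = (λ 1≢0 _ → 1≢0 refl) , (λ 0≢0 _ → 0≢0 refl)
indicator≢0⇔≢0 (ℕ.suc _) = (λ _ ()) , (λ _ ())

indicator-split : ∀ k → k ≡ k ℕ.∸ indicator k ℕ.+ indicator k
indicator-split ℕ.zero    = refl
indicator-split (ℕ.suc k) = sym (ℕ.+-comm k 1)

lemma8 : (m n : ℕ) (A : Matrix m n) (b : Fin m → ℤ) (c : Fin n → ℤ) →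
    (∃ λ x → Feasible A b x) → Bounded A b c →
    (xstar : Fin n → ℕ) → LexMinOptimal A b c xstar →
    Σ (Fin n → ℕ) λ x′ → Σ (Fin m → ℤ) λ b′ →
    (∀ i → x′ i ≤ 1) × LexMinOptimal A b′ c x′ × SameSupport x′ xstar
lemma8 m n A b c _ _ xstar xstar-lexmin =
  x′ , mulVec A x′ , (λ i → indicator≤1 (xstar i)) ,
  LexMinOptimal-shift A c (λ j → indicator-split (xstar j)) xstar-lexmin ,
  (λ i → indicator≢0⇔≢0 (xstar i))
  where
  x′ : Fin n → ℕ
  x′ i = indicator (xstar i)
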